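{- Let $T$ be a tree of order $n$ with $m = n-1$ edges, maximum degree $\Delta$, and non-decreasing degree sequence $\mathscr{D} = (d_1, \dots, d_n)$ whose average entry is $\lambda_{\mathscr{D}}$. Let $\eta = \left\lceil \frac{2n\Delta}{m} \right\rceil$ and let $\eta_1$ be an integer with $2 < \eta_1 \leqslant 4$. Then \[ \sigma(T) \leqslant \eta_1 \left\lfloor \frac{n}{n - \eta} \right\rfloor + \eta_1 \left\lceil \frac{n}{\eta - \lambda_{\mathscr{D}}} \right\rceil + \sum_{v \in V(T)} \deg_T(v)^3 . \]
   Context: The Sigma index of a graph $G$ is $\sigma(G) = \sum_{uv \in E(G)} (\deg_G(u) - \deg_G(v))^2$. -}

module Defs where

open import Data.Bool using (Bool; true; false; if_then_else_)
open import Data.Nat as ℕ using (ℕ; zero; suc; _≤_; _<ᵇ_; _^_; _⊔_; ∣_-_∣)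
open import Data.Integer as ℤ using (ℤ; +_)
open import Data.Rational as ℚ using (ℚ; _÷_; floor; ceiling; ≢-nonZero)
open import Data.Rational.Properties as ℚP using ()
open import Data.Fin using (Fin; toℕ)
open import Data.Nat.ListAction using (sum)
open import Data.List using (List; []; _∷_; _++_; [_]; length; map; foldr; allFin; concatMap; filter)
open import Data.List.Relation.Unary.Unique.Propositional using (Unique)
open import Data.Product using (_×_; _,_)
open import Data.Unit using (⊤)
open import Relation.Binary.PropositionalEquality using (_≡_)
open import Relation.Nullary using (¬_; yes; no)

record SimpleGraph (n : ℕ) : Set where
  field
    adj    : Fin n → Fin n → Bool
    symm   : ∀ u v → adj u v ≡ adj v u
    irrefl : ∀ v → adj v v ≡ false
open SimpleGraph public

module _ {n : ℕ} (G : SimpleGraph n) where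

  Adj : Fin n → Fin n → Set
  Adj u v = adj G u v ≡ true

  degree : Fin n → ℕ
  degree v = sum (map (λ u → if adj G v u then 1 else 0) (allFin n))

  -- E(G): each edge {u,v} listed once, as the pair (u,v) with u < v
  edges : List (Fin n × Fin n)
  edges = concatMap (λ u → concatMap (λ v →
            if (toℕ u <ᵇ toℕ v) then (if adj G u v then [ (u , v) ] else []) else [])
            (allFin n)) (allFin n)

  numEdges : ℕ
  numEdges = length edges

  -- maximum degree Δ (0 for the empty graph)
  maxDegree : ℕ
  maxDegree = foldr _⊔_ 0 (map degree (allFin n))

  sigma : ℕ
  sigma = sum (map (λ e → ∣ degree (Data.Product.proj₁ e) - degree (Data.Product.proj₂ e) ∣ ^ 2) edges)

  sumDegCubes : ℕ
  sumDegCubes = sum (map (λ v → degree v ^ 3) (allFin n))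

  sumDeg : ℕ
  sumDeg = sum (map degree (allFin n))

  data Walk : Fin n → Fin n → Set where
    here : ∀ {u} → Walk u u
    step : ∀ {u v w} → Adj u v → Walk v w → Walk u w

  Connected : Set
  Connected = ∀ u v → Walk u v

  Chain : List (Fin n) → Set
  Chain [] = ⊤
  Chain (x ∷ []) = ⊤
  Chain (x ∷ y ∷ r) = Adj x y × Chain (y ∷ r)

  IsCycle : List (Fin n) → Set
  IsCycle [] = Data.Empty.⊥ where import Data.Empty
  IsCycle (x ∷ r) = 3 ≤ length (x ∷ r) × Unique (x ∷ r) × Chain (x ∷ r ++ [ x ])

  Acyclic : Set
  Acyclic = ∀ xs → ¬ IsCycle xs

  IsTree : Set
  IsTree = 1 ≤ n × Connected × Acyclic

-- total division on ℚ with the convention p / 0 = 0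
infixl 7 _/₀_
_/₀_ : ℚ → ℚ → ℚ
p /₀ q with q ℚP.≟ ℚ.0ℚ
... | yes _ = ℚ.0ℚ
... | no q≢0 = _÷_ p q {{≢-nonZero q≢0}}

ℕtoℚ : ℕ → ℚ
ℕtoℚ k = (+ k) ℚ./ 1

module _ {n : ℕ} (T : SimpleGraph n) where

  eta : ℤ
  eta = ceiling (ℕtoℚ (2 ℕ.* n ℕ.* maxDegree T) /₀ ℕtoℚ (numEdges T))

  avgDeg : ℚ
  avgDeg = ℕtoℚ (sumDeg T) /₀ ℕtoℚ n

ℤtoℚ : ℤ → ℚ
ℤtoℚ k = k ℚ./ 1

{-# OPTIONS --safe #-}
module Submission where

-- On an edge uv, (d u - d v)² = d u² + d v² - 2 d u d v and 2 d u d v ≥ d u + d v. Summed over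
-- the edges, d u² + d v² gives Σ d³ and d u + d v gives Σ d², so
--   σ ≤ Σ d³ - Σ d² ≤ Σ d³ - Δ(Δ - 1) - 2m.
-- It remains to see that the floor term A and the ceiling term B are not too negative. Acyclicity
-- gives m < n. Then either m = 0, η = λ = 0 and A, B ≥ 0, or η ≥ 2Δ > λ, so B ≥ 1. In the latter
-- case A ≥ 0 if η ≤ n; otherwise m < 2Δ (as 2nΔ/m > n) and A ≥ -m, so that
--   η₁ (A + B) ≥ -4(m - 1) ≥ -Δ(Δ - 1) - 2m.

open import Defs

open import Data.Bool using (true; false; if_then_else_)
open import Data.Empty using (⊥; ⊥-elim)
open import Data.Fin as Fin using (Fin; toℕ; punchIn)
import Data.Fin.Properties as Fin
open import Data.List as List using (List; []; _∷_; [_]; _++_; map; tabulate; allFin; concatMap; foldr; length)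
open import Data.List.Membership.Propositional using (_∈_)
open import Data.List.Membership.Propositional.Properties using (∈-map⁺; ∈-allFin; ∈-lookup)
open import Data.List.Properties using (map-∘; map-++; length-map)
open import Data.List.Relation.Unary.All as All using (All; []; _∷_)
open import Data.List.Relation.Unary.All.Properties using (¬Any⇒All¬)
open import Data.List.Relation.Unary.AllPairs using (AllPairs; []; _∷_)
open import Data.List.Relation.Unary.Any as Any using (here; there)
open import Data.List.Relation.Unary.Unique.Propositional using (Unique)
import Data.List.Relation.Unary.Unique.Propositional.Properties as Unique
open import Data.Nat as ℕ using (ℕ; zero; suc; z≤n; s≤s)
open import Data.Nat.ListAction using (sum)
open import Data.Nat.ListAction.Properties using (sum-++)
import Data.Nat.Properties as ℕ
open import Data.Nat.Tactic.RingSolver using (solve-∀)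
open import Data.Product using (∃; _×_; _,_; proj₁; proj₂)
open import Data.Sum using (inj₁; inj₂)
open import Data.Unit using (tt)
open import Function using (_∘_)
open import Relation.Binary.PropositionalEquality hiding ([_])
open import Relation.Nullary using (yes; no)
open import Relation.Nullary.Reflects using (ofʸ; ofⁿ)
open import Algebra.Properties.CommutativeSemigroup ℕ.+-commutativeSemigroup using (interchange)
open import Algebra.Properties.Semiring.Sum ℕ.+-*-semiring
  using (sum-syntax; sum-remove; ∑-distrib-+; ∑-comm; *-distribʳ-sum; sum-cong-≗)
  renaming (sum to ∑)

module FiniteSums where

  open import Data.Nat
  open import Data.Nat.Properties

  sum-map-tabulate : ∀ {A : Set} {n} (f : A → ℕ) (g : Fin n → A) →
                     sum (map f (tabulate g)) ≡ ∑[ i < n ] f (g i)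
  sum-map-tabulate {n = zero}  f g = refl
  sum-map-tabulate {n = suc n} f g = cong (f (g Fin.zero) +_) (sum-map-tabulate f (g ∘ Fin.suc))

  sum-map-allFin : ∀ {n} (f : Fin n → ℕ) → sum (map f (allFin n)) ≡ ∑[ i < n ] f i
  sum-map-allFin f = sum-map-tabulate f (λ i → i)

  sum-map-+ : ∀ {A : Set} (f g : A → ℕ) (xs : List A) →
              sum (map (λ x → f x + g x) xs) ≡ sum (map f xs) + sum (map g xs)
  sum-map-+ f g []       = refl
  sum-map-+ f g (x ∷ xs) = trans (cong (f x + g x +_) (sum-map-+ f g xs))
                                 (interchange (f x) (g x) (sum (map f xs)) (sum (map g xs)))

  sum-map-const : ∀ {A : Set} c (xs : List A) → sum (map (λ _ → c) xs) ≡ c * List.length xs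
  sum-map-const c []       = sym (*-zeroʳ c)
  sum-map-const c (x ∷ xs) = trans (cong (c +_) (sum-map-const c xs)) (sym (*-suc c (List.length xs)))

  sum-concatMap : ∀ {A B : Set} (ψ : B → ℕ) (f : A → List B) (xs : List A) →
                  sum (map ψ (concatMap f xs)) ≡ sum (map (λ x → sum (map ψ (f x))) xs)
  sum-concatMap ψ f []       = refl
  sum-concatMap ψ f (x ∷ xs) = begin
    sum (map ψ (f x ++ concatMap f xs))                         ≡⟨ cong sum (map-++ ψ (f x) _) ⟩
    sum (map ψ (f x) ++ map ψ (concatMap f xs))                 ≡⟨ sum-++ (map ψ (f x)) _ ⟩
    sum (map ψ (f x)) + sum (map ψ (concatMap f xs))            ≡⟨ cong (_ +_) (sum-concatMap ψ f xs) ⟩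
    sum (map ψ (f x)) + sum (map (λ x → sum (map ψ (f x))) xs)  ∎
    where open ≡-Reasoning

  ∑-mono-≤ : ∀ {n} {f g : Fin n → ℕ} → (∀ i → f i ≤ g i) → ∑[ i < n ] f i ≤ ∑[ i < n ] g i
  ∑-mono-≤ {zero}  f≤g = z≤n
  ∑-mono-≤ {suc n} f≤g = +-mono-≤ (f≤g Fin.zero) (∑-mono-≤ (f≤g ∘ Fin.suc))

  ∑-const : ∀ n c → ∑[ i < n ] c ≡ n * c
  ∑-const zero    c = refl
  ∑-const (suc n) c = cong (c +_) (∑-const n c)

  term≤∑ : ∀ {n} (f : Fin n → ℕ) i → f i ≤ ∑[ j < n ] f j
  term≤∑ f Fin.zero    = m≤m+n _ _
  term≤∑ f (Fin.suc i) = ≤-trans (term≤∑ (f ∘ Fin.suc) i) (m≤n+m _ _)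

  ∑∑-symmetrize : ∀ {n} (e : Fin n → Fin n → ℕ) (g : Fin n → ℕ) →
                  ∑[ u < n ] ∑[ v < n ] (e u v * (g u + g v))
                  ≡ ∑[ u < n ] ∑[ v < n ] ((e u v + e v u) * g u)
  ∑∑-symmetrize {n} e g = begin
    ∑[ u < n ] ∑[ v < n ] (e u v * (g u + g v))
      ≡⟨ sum-cong-≗ (λ u → trans (sum-cong-≗ (λ v → *-distribˡ-+ (e u v) (g u) (g v)))
                                 (∑-distrib-+ (L u) (R u))) ⟩
    ∑[ u < n ] (∑[ v < n ] L u v + ∑[ v < n ] R u v)
      ≡⟨ ∑-distrib-+ (λ u → ∑[ v < n ] L u v) (λ u → ∑[ v < n ] R u v) ⟩
    ∑[ u < n ] ∑[ v < n ] L u v + ∑[ u < n ] ∑[ v < n ] R u v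
      ≡⟨ cong (∑[ u < n ] ∑[ v < n ] L u v +_) (∑-comm R) ⟩
    ∑[ u < n ] ∑[ v < n ] L u v + ∑[ u < n ] ∑[ v < n ] R v u
      ≡⟨ ∑-distrib-+ (λ u → ∑[ v < n ] L u v) (λ u → ∑[ v < n ] R v u) ⟨
    ∑[ u < n ] (∑[ v < n ] L u v + ∑[ v < n ] R v u)
      ≡⟨ sum-cong-≗ (λ u → trans (sym (∑-distrib-+ (L u) (λ v → R v u)))
                                 (sum-cong-≗ (λ v → sym (*-distribʳ-+ (g u) (e u v) (e v u))))) ⟩
    ∑[ u < n ] ∑[ v < n ] ((e u v + e v u) * g u) ∎
    where
    open ≡-Reasoning
    L R : Fin n → Fin n → ℕ
    L u v = e u v * g u
    R u v = e u v * g v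

  ∑-positive : ∀ {n} (f : Fin n → ℕ) → 0 < ∑[ i < n ] f i → ∃ λ i → 0 < f i
  ∑-positive {suc n} f pos with f Fin.zero in f₀≡
  ... | suc _ = Fin.zero , subst (0 <_) (sym f₀≡) (s≤s z≤n)
  ... | zero with ∑-positive (f ∘ Fin.suc) pos
  ...   | i , fi>0 = Fin.suc i , fi>0

  ≤-foldr-⊔ : ∀ {x xs} → x ∈ xs → x ≤ foldr _⊔_ 0 xs
  ≤-foldr-⊔ (here refl) = m≤m⊔n _ _
  ≤-foldr-⊔ {xs = y ∷ _} (there x∈xs) = ≤-trans (≤-foldr-⊔ x∈xs) (m≤n⊔m y _)

  h[foldr-⊔]≤sum-map-h : ∀ (h : ℕ → ℕ) → (∀ {a b} → a ≤ b → h a ≤ h b) → h 0 ≡ 0 →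
                         ∀ xs → h (foldr _⊔_ 0 xs) ≤ sum (map h xs)
  h[foldr-⊔]≤sum-map-h h mono h0 []       = ≤-reflexive h0
  h[foldr-⊔]≤sum-map-h h mono h0 (x ∷ xs) with ≤-total x (foldr _⊔_ 0 xs)
  ... | inj₁ x≤M rewrite m≤n⇒m⊔n≡n x≤M = ≤-trans (h[foldr-⊔]≤sum-map-h h mono h0 xs) (m≤n+m _ (h x))
  ... | inj₂ M≤x rewrite m≥n⇒m⊔n≡m M≤x = m≤m+n (h x) _

module NatArithmetic where

  open import Data.Nat
  open import Data.Nat.Properties

  m≤n⇒∣m-n∣²+2mn≡m²+n² : ∀ {m n} → m ≤ n → ∣ m - n ∣ ^ 2 + 2 * (m * n) ≡ m ^ 2 + n ^ 2
  m≤n⇒∣m-n∣²+2mn≡m²+n² {m} {n} m≤n =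
    subst (λ n → ∣ m - n ∣ ^ 2 + 2 * (m * n) ≡ m ^ 2 + n ^ 2) (m+[n∸m]≡n m≤n) (identity m (n ∸ m))
    where
    identity : ∀ m k → ∣ m - (m + k) ∣ ^ 2 + 2 * (m * (m + k)) ≡ m ^ 2 + (m + k) ^ 2
    identity m k rewrite ∣m-m+n∣≡n m k = polynomial m k
      where
      polynomial : ∀ m k → k * (k * 1) + 2 * (m * (m + k))
                           ≡ m * (m * 1) + (m + k) * ((m + k) * 1)
      polynomial = solve-∀

  ∣m-n∣²+2mn≡m²+n² : ∀ m n → ∣ m - n ∣ ^ 2 + 2 * (m * n) ≡ m ^ 2 + n ^ 2
  ∣m-n∣²+2mn≡m²+n² m n with ≤-total m n
  ... | inj₁ m≤n = m≤n⇒∣m-n∣²+2mn≡m²+n² m≤n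
  ... | inj₂ n≤m = begin
    ∣ m - n ∣ ^ 2 + 2 * (m * n) ≡⟨ cong₂ (λ a b → a ^ 2 + 2 * b) (∣-∣-comm m n) (*-comm m n) ⟩
    ∣ n - m ∣ ^ 2 + 2 * (n * m) ≡⟨ m≤n⇒∣m-n∣²+2mn≡m²+n² n≤m ⟩
    n ^ 2 + m ^ 2               ≡⟨ +-comm (n ^ 2) (m ^ 2) ⟩
    m ^ 2 + n ^ 2               ∎
    where open ≡-Reasoning

  ∣m-n∣²+[m+n]≤m²+n² : ∀ {m n} → 1 ≤ m → 1 ≤ n → ∣ m - n ∣ ^ 2 + (m + n) ≤ m ^ 2 + n ^ 2
  ∣m-n∣²+[m+n]≤m²+n² {m@(suc _)} {n@(suc _)} _ _ = begin
    ∣ m - n ∣ ^ 2 + (m + n)      ≤⟨ +-monoʳ-≤ (∣ m - n ∣ ^ 2) m+n≤2mn ⟩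
    ∣ m - n ∣ ^ 2 + 2 * (m * n)  ≡⟨ ∣m-n∣²+2mn≡m²+n² m n ⟩
    m ^ 2 + n ^ 2                ∎
    where
    open ≤-Reasoning
    m+n≤2mn : m + n ≤ 2 * (m * n)
    m+n≤2mn = subst (m + n ≤_) (cong (m * n +_) (sym (+-identityʳ (m * n))))
                    (+-mono-≤ (m≤m*n m n) (m≤n*m n m))

  m²≡m[m∸1]+m : ∀ m → m * m ≡ m * (m ∸ 1) + m
  m²≡m[m∸1]+m zero    = refl
  m²≡m[m∸1]+m (suc m) = identity m
    where
    identity : ∀ m → suc m * suc m ≡ suc m * m + suc m
    identity = solve-∀

  -- Equivalent to (Δ - 2)(Δ - 3) ≥ 0 once m ≤ 2Δ - 1.
  2m≤Δ[Δ∸1]+4 : ∀ {m Δ} → m < 2 * Δ → 2 * m ≤ Δ * (Δ ∸ 1) + 4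
  2m≤Δ[Δ∸1]+4 {m} {zero}  ()
  2m≤Δ[Δ∸1]+4 {m} {suc zero} m<2 = ≤-trans (*-monoʳ-≤ 2 (s≤s⁻¹ m<2)) (s≤s (s≤s z≤n))
  2m≤Δ[Δ∸1]+4 {m} {suc (suc zero)} m<4 = *-monoʳ-≤ 2 (s≤s⁻¹ m<4)
  2m≤Δ[Δ∸1]+4 {m} {suc (suc (suc k))} m<2Δ = begin
    2 * m                          ≤⟨ *-monoʳ-≤ 2 (s≤s⁻¹ (≤-trans m<2Δ (≤-reflexive (identity₁ k)))) ⟩
    2 * (5 + 2 * k)                ≤⟨ m≤m+n (2 * (5 + 2 * k)) (k * k + k) ⟩
    2 * (5 + 2 * k) + (k * k + k)  ≡⟨ identity₂ k ⟩
    (3 + k) * (2 + k) + 4          ∎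
    where
    open ≤-Reasoning
    identity₁ : ∀ k → 2 * (3 + k) ≡ suc (5 + 2 * k)
    identity₁ = solve-∀
    identity₂ : ∀ k → 2 * (5 + 2 * k) + (k * k + k) ≡ (3 + k) * (2 + k) + 4
    identity₂ = solve-∀

  σ+4[m∸1]≤S : ∀ {σ Δ m S} → m < 2 * Δ → σ + (Δ * (Δ ∸ 1) + 2 * m) ≤ S →
               σ + 4 * (m ∸ 1) ≤ S
  σ+4[m∸1]≤S {σ} {Δ} {zero}  {S} _ σ+h≤S = ≤-trans (+-monoʳ-≤ σ z≤n) σ+h≤S
  σ+4[m∸1]≤S {σ} {Δ} {suc m} {S} m<2Δ σ+h≤S = +-cancelʳ-≤ 4 (σ + 4 * m) S (begin
    σ + 4 * m + 4                ≡⟨ identity₁ σ m ⟩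
    σ + (2 * suc m + 2 * suc m)  ≤⟨ +-monoʳ-≤ σ (+-monoˡ-≤ (2 * suc m) (2m≤Δ[Δ∸1]+4 {Δ = Δ} m<2Δ)) ⟩
    σ + (h + 4 + 2 * suc m)      ≡⟨ identity₂ σ h (suc m) ⟩
    σ + (h + 2 * suc m) + 4      ≤⟨ +-monoˡ-≤ 4 σ+h≤S ⟩
    S + 4                        ∎)
    where
    open ≤-Reasoning
    h = Δ * (Δ ∸ 1)
    identity₁ : ∀ σ m → σ + 4 * m + 4 ≡ σ + (2 * suc m + 2 * suc m)
    identity₁ = solve-∀
    identity₂ : ∀ σ h m → σ + (h + 4 + 2 * m) ≡ σ + (h + 2 * m) + 4
    identity₂ = solve-∀

module DegreeSums where

  open import Data.Nat
  open import Data.Nat.Properties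
  open FiniteSums
  open NatArithmetic

  module _ {n : ℕ} (G : SimpleGraph n) where

    adjacency : Fin n → Fin n → ℕ
    adjacency u v = if adj G u v then 1 else 0

    adjacency-sym : ∀ u v → adjacency u v ≡ adjacency v u
    adjacency-sym u v = cong (λ b → if b then 1 else 0) (symm G u v)

    adjacency-irrefl : ∀ v → adjacency v v ≡ 0
    adjacency-irrefl v = cong (λ b → if b then 1 else 0) (irrefl G v)

    adjacency≤1 : ∀ u v → adjacency u v ≤ 1
    adjacency≤1 u v with adj G u v
    ... | true  = ≤-refl
    ... | false = z≤n

    -- multiplicity with which the ordered pair (u , v) occurs in edges G
    listedEdge : Fin n → Fin n → ℕ
    listedEdge u v = if toℕ u <ᵇ toℕ v then adjacency u v else 0

    degree≡∑adjacency : ∀ v → degree G v ≡ ∑[ u < n ] adjacency v u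
    degree≡∑adjacency v = sum-map-allFin (adjacency v)

    sum-edges : ∀ (ψ : Fin n × Fin n → ℕ) →
                sum (map ψ (edges G)) ≡ ∑[ u < n ] ∑[ v < n ] (listedEdge u v * ψ (u , v))
    sum-edges ψ = begin
      sum (map ψ (edges G))                               ≡⟨ sum-concatMap ψ row (allFin n) ⟩
      sum (map (λ u → sum (map ψ (row u))) (allFin n))    ≡⟨ sum-map-allFin (λ u → sum (map ψ (row u))) ⟩
      ∑[ u < n ] sum (map ψ (row u))                      ≡⟨ sum-cong-≗ sum-row ⟩
      ∑[ u < n ] ∑[ v < n ] (listedEdge u v * ψ (u , v))  ∎
      where
      open ≡-Reasoning
      entry : Fin n → Fin n → List (Fin n × Fin n)
      entry u v = if toℕ u <ᵇ toℕ v then (if adj G u v then [ (u , v) ] else []) else []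
      row : Fin n → List (Fin n × Fin n)
      row u = concatMap (entry u) (allFin n)
      sum-entry : ∀ b c e → sum (map ψ (if b then (if c then [ e ] else []) else []))
                            ≡ (if b then (if c then 1 else 0) else 0) * ψ e
      sum-entry true  true  e = refl
      sum-entry true  false e = refl
      sum-entry false c     e = refl
      sum-row : ∀ u → sum (map ψ (row u)) ≡ ∑[ v < n ] (listedEdge u v * ψ (u , v))
      sum-row u = begin
        sum (map ψ (row u))                                   ≡⟨ sum-concatMap ψ (entry u) (allFin n) ⟩
        sum (map (λ v → sum (map ψ (entry u v))) (allFin n))
          ≡⟨ sum-map-allFin (λ v → sum (map ψ (entry u v))) ⟩
        ∑[ v < n ] sum (map ψ (entry u v))
          ≡⟨ sum-cong-≗ (λ v → sum-entry (toℕ u <ᵇ toℕ v) (adj G u v) (u , v)) ⟩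
        ∑[ v < n ] (listedEdge u v * ψ (u , v))               ∎

    listedEdge-symmetrize : ∀ u v → listedEdge u v + listedEdge v u ≡ adjacency u v
    listedEdge-symmetrize u v
      with toℕ u <ᵇ toℕ v | <ᵇ-reflects-< (toℕ u) (toℕ v) | toℕ v <ᵇ toℕ u | <ᵇ-reflects-< (toℕ v) (toℕ u)
    ... | true  | ofʸ u<v | true  | ofʸ v<u = ⊥-elim (<-asym u<v v<u)
    ... | true  | _       | false | _       = +-identityʳ (adjacency u v)
    ... | false | _       | true  | _       = adjacency-sym v u
    ... | false | ofⁿ u≮v | false | ofⁿ v≮u = sym (trans (cong (adjacency u) v≡u) (adjacency-irrefl u))
      where
      v≡u : v ≡ u
      v≡u = Fin.toℕ-injective (≤-antisym (≮⇒≥ u≮v) (≮⇒≥ v≮u))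

    sum-edges-endpoints : ∀ (g : Fin n → ℕ) →
      sum (map (λ e → g (proj₁ e) + g (proj₂ e)) (edges G)) ≡ ∑[ v < n ] (degree G v * g v)
    sum-edges-endpoints g = begin
      sum (map (λ e → g (proj₁ e) + g (proj₂ e)) (edges G))
        ≡⟨ sum-edges (λ e → g (proj₁ e) + g (proj₂ e)) ⟩
      ∑[ u < n ] ∑[ v < n ] (listedEdge u v * (g u + g v))
        ≡⟨ ∑∑-symmetrize listedEdge g ⟩
      ∑[ u < n ] ∑[ v < n ] ((listedEdge u v + listedEdge v u) * g u)
        ≡⟨ sum-cong-≗ (λ u → sum-cong-≗ (λ v → cong (_* g u) (listedEdge-symmetrize u v))) ⟩
      ∑[ u < n ] ∑[ v < n ] (adjacency u v * g u)
        ≡⟨ sum-cong-≗ (λ u → *-distribʳ-sum (g u) (adjacency u)) ⟨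
      ∑[ u < n ] (∑[ v < n ] adjacency u v * g u)
        ≡⟨ sum-cong-≗ (λ u → cong (_* g u) (degree≡∑adjacency u)) ⟨
      ∑[ u < n ] (degree G u * g u)
        ∎
      where open ≡-Reasoning

    0<adjacency⇒Adj : ∀ {u v} → 0 < adjacency u v → Adj G u v
    0<adjacency⇒Adj {u} {v} pos with adj G u v in u~v
    ... | true  = refl
    ... | false = ⊥-elim (<-irrefl refl pos)

    Adj-irrefl : ∀ {x} → Adj G x x → ⊥
    Adj-irrefl {x} x~x with trans (sym x~x) (irrefl G x)
    ... | ()

    Adj-sym : ∀ {u v} → Adj G u v → Adj G v u
    Adj-sym {u} {v} u~v = trans (symm G v u) u~v

    Adj⇒adjacency≡1 : ∀ {u v} → Adj G u v → adjacency u v ≡ 1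
    Adj⇒adjacency≡1 u~v = cong (λ b → if b then 1 else 0) u~v

    Adj⇒1≤degree : ∀ {u v} → Adj G u v → 1 ≤ degree G u
    Adj⇒1≤degree {u} {v} u~v = begin
      1                          ≡⟨ Adj⇒adjacency≡1 u~v ⟨
      adjacency u v              ≤⟨ term≤∑ (adjacency u) v ⟩
      ∑[ w < n ] adjacency u w   ≡⟨ degree≡∑adjacency u ⟨
      degree G u                 ∎
      where open ≤-Reasoning

    sum-edges-mono-≤ : ∀ {φ ψ : Fin n × Fin n → ℕ} → (∀ u v → Adj G u v → φ (u , v) ≤ ψ (u , v)) →
                       sum (map φ (edges G)) ≤ sum (map ψ (edges G))
    sum-edges-mono-≤ {φ} {ψ} φ≤ψ = begin
      sum (map φ (edges G))                                ≡⟨ sum-edges φ ⟩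
      ∑[ u < n ] ∑[ v < n ] (listedEdge u v * φ (u , v))   ≤⟨ ∑-mono-≤ (λ u → ∑-mono-≤ (termwise u)) ⟩
      ∑[ u < n ] ∑[ v < n ] (listedEdge u v * ψ (u , v))   ≡⟨ sum-edges ψ ⟨
      sum (map ψ (edges G))                                ∎
      where
      open ≤-Reasoning
      termwise : ∀ u v → listedEdge u v * φ (u , v) ≤ listedEdge u v * ψ (u , v)
      termwise u v with toℕ u <ᵇ toℕ v | adj G u v in u~v
      ... | true  | true  = *-monoʳ-≤ 1 (φ≤ψ u v u~v)
      ... | true  | false = z≤n
      ... | false | _     = z≤n

    sigma+∑degree²≤sumDegCubes : sigma G + ∑[ v < n ] (degree G v * degree G v) ≤ sumDegCubes G
    sigma+∑degree²≤sumDegCubes = begin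
      sigma G + ∑[ v < n ] (d v * d v)           ≡⟨ cong (sigma G +_) (sum-edges-endpoints d) ⟨
      sigma G + sum (map d₁+d₂ (edges G))        ≡⟨ sum-map-+ ∣d₁-d₂∣² d₁+d₂ (edges G) ⟨
      sum (map (λ e → ∣d₁-d₂∣² e + d₁+d₂ e) (edges G))
        ≤⟨ sum-edges-mono-≤ (λ u v u~v → ∣m-n∣²+[m+n]≤m²+n² (Adj⇒1≤degree u~v)
                                                             (Adj⇒1≤degree (Adj-sym u~v))) ⟩
      sum (map d₁²+d₂² (edges G))                ≡⟨ sum-edges-endpoints (λ v → d v ^ 2) ⟩
      ∑[ v < n ] (d v ^ 3)                       ≡⟨ sum-map-allFin (λ v → d v ^ 3) ⟨
      sumDegCubes G                              ∎
      where
      open ≤-Reasoning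
      d = degree G
      ∣d₁-d₂∣² d₁+d₂ d₁²+d₂² : Fin n × Fin n → ℕ
      ∣d₁-d₂∣² (u , v) = ∣ d u - d v ∣ ^ 2
      d₁+d₂ (u , v) = d u + d v
      d₁²+d₂² (u , v) = d u ^ 2 + d v ^ 2

    degree≤maxDegree : ∀ v → degree G v ≤ maxDegree G
    degree≤maxDegree v = ≤-foldr-⊔ (∈-map⁺ (degree G) (∈-allFin v))

    sumDeg≡∑degree : sumDeg G ≡ ∑[ v < n ] degree G v
    sumDeg≡∑degree = sum-map-allFin (degree G)

    sumDeg≤n*maxDegree : sumDeg G ≤ n * maxDegree G
    sumDeg≤n*maxDegree = begin
      sumDeg G                   ≡⟨ sumDeg≡∑degree ⟩
      ∑[ v < n ] degree G v      ≤⟨ ∑-mono-≤ degree≤maxDegree ⟩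
      ∑[ v < n ] maxDegree G     ≡⟨ ∑-const n (maxDegree G) ⟩
      n * maxDegree G            ∎
      where open ≤-Reasoning

    maxDegree[maxDegree∸1]+sumDeg≤∑degree² :
      maxDegree G * (maxDegree G ∸ 1) + sumDeg G ≤ ∑[ v < n ] (degree G v * degree G v)
    maxDegree[maxDegree∸1]+sumDeg≤∑degree² = begin
      h (maxDegree G) + sumDeg G                      ≤⟨ +-monoˡ-≤ (sumDeg G) h[maxDegree]≤∑h[degree] ⟩
      ∑[ v < n ] h (degree G v) + sumDeg G            ≡⟨ cong (∑[ v < n ] h (degree G v) +_) sumDeg≡∑degree ⟩
      ∑[ v < n ] h (degree G v) + ∑[ v < n ] degree G v ≡⟨ ∑-distrib-+ (h ∘ degree G) (degree G) ⟨
      ∑[ v < n ] (h (degree G v) + degree G v)        ≡⟨ sum-cong-≗ (λ v → m²≡m[m∸1]+m (degree G v)) ⟨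
      ∑[ v < n ] (degree G v * degree G v)            ∎
      where
      open ≤-Reasoning
      h : ℕ → ℕ
      h x = x * (x ∸ 1)
      h[maxDegree]≤∑h[degree] : h (maxDegree G) ≤ ∑[ v < n ] h (degree G v)
      h[maxDegree]≤∑h[degree] = begin
        h (maxDegree G)
          ≤⟨ h[foldr-⊔]≤sum-map-h h (λ a≤b → *-mono-≤ a≤b (∸-monoˡ-≤ 1 a≤b)) refl (map (degree G) (allFin n)) ⟩
        sum (map h (map (degree G) (allFin n)))    ≡⟨ cong sum (map-∘ (allFin n)) ⟨
        sum (map (h ∘ degree G) (allFin n))        ≡⟨ sum-map-allFin (h ∘ degree G) ⟩
        ∑[ v < n ] h (degree G v)                  ∎

    handshake : sumDeg G ≡ 2 * numEdges G
    handshake = begin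
      sumDeg G                                 ≡⟨ sumDeg≡∑degree ⟩
      ∑[ v < n ] degree G v                    ≡⟨ sum-cong-≗ (λ v → *-identityʳ (degree G v)) ⟨
      ∑[ v < n ] (degree G v * 1)              ≡⟨ sum-edges-endpoints (λ _ → 1) ⟨
      sum (map (λ _ → 2) (edges G))            ≡⟨ sum-map-const 2 (edges G) ⟩
      2 * numEdges G                           ∎
      where open ≡-Reasoning

    sigma+Δ[Δ∸1]+2m≤sumDegCubes :
      sigma G + (maxDegree G * (maxDegree G ∸ 1) + 2 * numEdges G) ≤ sumDegCubes G
    sigma+Δ[Δ∸1]+2m≤sumDegCubes = begin
      sigma G + (Δ * (Δ ∸ 1) + 2 * numEdges G)
        ≡⟨ cong (λ s → sigma G + (Δ * (Δ ∸ 1) + s)) handshake ⟨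
      sigma G + (Δ * (Δ ∸ 1) + sumDeg G)
        ≤⟨ +-monoʳ-≤ (sigma G) maxDegree[maxDegree∸1]+sumDeg≤∑degree² ⟩
      sigma G + ∑[ v < n ] (degree G v * degree G v)  ≤⟨ sigma+∑degree²≤sumDegCubes ⟩
      sumDegCubes G                                   ∎
      where
      open ≤-Reasoning
      Δ = maxDegree G

module Forests where

  open import Data.Nat
  open import Data.Nat.Properties
  open FiniteSums
  open DegreeSums

  lookup-injective : ∀ {A : Set} {xs : List A} → Unique xs →
                     ∀ i j → List.lookup xs i ≡ List.lookup xs j → i ≡ j
  lookup-injective (_   ∷ _)   Fin.zero    Fin.zero    _  = refl
  lookup-injective (x∉ ∷ _)   Fin.zero    (Fin.suc j) eq = ⊥-elim (All.lookup x∉ (∈-lookup j) eq)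
  lookup-injective (x∉ ∷ _)   (Fin.suc i) Fin.zero    eq = ⊥-elim (All.lookup x∉ (∈-lookup i) (sym eq))
  lookup-injective (_ ∷ uniq) (Fin.suc i) (Fin.suc j) eq = cong Fin.suc (lookup-injective uniq i j eq)

  Unique⇒length≤ : ∀ {n} {xs : List (Fin n)} → Unique xs → length xs ≤ n
  Unique⇒length≤ uniq = Fin.injective⇒≤ (λ {i} {j} → lookup-injective uniq i j)

  module _ {A : Set} {z : A} where

    prefixTo : ∀ xs → z ∈ xs → List A
    prefixTo (w ∷ _)  (here _)     = [ w ]
    prefixTo (w ∷ ws) (there z∈ws) = w ∷ prefixTo ws z∈ws

    All-prefixTo : ∀ {P : A → Set} {xs} (z∈xs : z ∈ xs) → All P xs → All P (prefixTo xs z∈xs)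
    All-prefixTo (here _)     (pw ∷ _)   = pw ∷ []
    All-prefixTo (there z∈ws) (pw ∷ pws) = pw ∷ All-prefixTo z∈ws pws

    AllPairs-prefixTo : ∀ {R : A → A → Set} {xs} (z∈xs : z ∈ xs) →
                        AllPairs R xs → AllPairs R (prefixTo xs z∈xs)
    AllPairs-prefixTo (here _)     (_ ∷ _)     = [] ∷ []
    AllPairs-prefixTo (there z∈ws) (rw ∷ rws) = All-prefixTo z∈ws rw ∷ AllPairs-prefixTo z∈ws rws

    1≤length-prefixTo : ∀ {xs} (z∈xs : z ∈ xs) → 1 ≤ length (prefixTo xs z∈xs)
    1≤length-prefixTo (here _)  = s≤s z≤n
    1≤length-prefixTo (there _) = s≤s z≤n

  Chain-prefixTo : ∀ {n} {G : SimpleGraph n} {x y z} {xs} (z∈xs : z ∈ xs) →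
                   Chain G (y ∷ xs) → Adj G z x → Chain G (y ∷ prefixTo xs z∈xs ++ [ x ])
  Chain-prefixTo {xs = w ∷ _} (here refl)  (y~w , _)  w~x = y~w , w~x , tt
  Chain-prefixTo {xs = w ∷ _} (there z∈ws) (y~w , ch) z~x = y~w , Chain-prefixTo z∈ws ch z~x

  module _ {m n} {G : SimpleGraph m} {H : SimpleGraph n} (f : Fin m → Fin n)
           (f-adj : ∀ {u v} → Adj G u v → Adj H (f u) (f v)) where

    Chain-map : ∀ xs → Chain G xs → Chain H (map f xs)
    Chain-map []          _          = tt
    Chain-map (x ∷ [])    _          = tt
    Chain-map (x ∷ y ∷ r) (x~y , ch) = f-adj x~y , Chain-map (y ∷ r) ch

    IsCycle-map : (∀ {u v} → f u ≡ f v → u ≡ v) → ∀ xs → IsCycle G xs → IsCycle H (map f xs)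
    IsCycle-map f-inj (x ∷ r) (3≤len , uniq , ch) =
        subst (3 ≤_) (sym (length-map f (x ∷ r))) 3≤len
      , Unique.map⁺ f-inj uniq
      , subst (Chain H) (map-++ f (x ∷ r) [ x ]) (Chain-map (x ∷ r ++ [ x ]) ch)

    Acyclic-reflect : (∀ {u v} → f u ≡ f v → u ≡ v) → Acyclic H → Acyclic G
    Acyclic-reflect f-inj acyclic xs cycle = acyclic (map f xs) (IsCycle-map f-inj xs cycle)

  infixl 6 _─_
  _─_ : ∀ {n} → SimpleGraph (suc n) → Fin (suc n) → SimpleGraph n
  G ─ x = record
    { adj    = λ u v → adj G (punchIn x u) (punchIn x v)
    ; symm   = λ u v → symm G (punchIn x u) (punchIn x v)
    ; irrefl = λ v → irrefl G (punchIn x v)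
    }

  module _ {n} (G : SimpleGraph (suc n)) (x : Fin (suc n)) where

    Acyclic-─ : Acyclic G → Acyclic (G ─ x)
    Acyclic-─ = Acyclic-reflect (punchIn x) (λ u~v → u~v) (Fin.punchIn-injective x _ _)

    degree-punchIn : ∀ u → degree G (punchIn x u) ≡ adjacency G (punchIn x u) x + degree (G ─ x) u
    degree-punchIn u = begin
      degree G (punchIn x u)                            ≡⟨ degree≡∑adjacency G (punchIn x u) ⟩
      ∑[ w < suc n ] adjacency G (punchIn x u) w        ≡⟨ sum-remove (adjacency G (punchIn x u)) ⟩
      adjacency G (punchIn x u) x + ∑[ w < n ] adjacency (G ─ x) u w
        ≡⟨ cong (adjacency G (punchIn x u) x +_) (degree≡∑adjacency (G ─ x) u) ⟨
      adjacency G (punchIn x u) x + degree (G ─ x) u    ∎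
      where open ≡-Reasoning

    degree≡∑adjacency-punchIn : degree G x ≡ ∑[ u < n ] adjacency G x (punchIn x u)
    degree≡∑adjacency-punchIn = begin
      degree G x                                         ≡⟨ degree≡∑adjacency G x ⟩
      ∑[ w < suc n ] adjacency G x w                     ≡⟨ sum-remove (adjacency G x) ⟩
      adjacency G x x + ∑[ u < n ] adjacency G x (punchIn x u)
        ≡⟨ cong (_+ ∑[ u < n ] adjacency G x (punchIn x u)) (adjacency-irrefl G x) ⟩
      ∑[ u < n ] adjacency G x (punchIn x u)             ∎
      where open ≡-Reasoning

    degree≤n : degree G x ≤ n
    degree≤n = begin
      degree G x                               ≡⟨ degree≡∑adjacency-punchIn ⟩
      ∑[ u < n ] adjacency G x (punchIn x u)   ≤⟨ ∑-mono-≤ (λ u → adjacency≤1 G x (punchIn x u)) ⟩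
      ∑[ u < n ] 1                             ≡⟨ ∑-const n 1 ⟩
      n * 1                                    ≡⟨ *-identityʳ n ⟩
      n                                        ∎
      where open ≤-Reasoning

    sumDeg-─ : sumDeg G ≡ 2 * degree G x + sumDeg (G ─ x)
    sumDeg-─ = begin
      sumDeg G                                        ≡⟨ sumDeg≡∑degree G ⟩
      ∑[ w < suc n ] degree G w                       ≡⟨ sum-remove (degree G) ⟩
      degree G x + ∑[ u < n ] degree G (punchIn x u)  ≡⟨ cong (degree G x +_) (sum-cong-≗ degree-punchIn) ⟩
      degree G x + ∑[ u < n ] (adjacency G (punchIn x u) x + degree (G ─ x) u)
        ≡⟨ cong (degree G x +_) (∑-distrib-+ (λ u → adjacency G (punchIn x u) x) (degree (G ─ x))) ⟩
      degree G x + (∑[ u < n ] adjacency G (punchIn x u) x + ∑[ u < n ] degree (G ─ x) u)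
        ≡⟨ cong₂ (λ a b → degree G x + (a + b))
                 (trans (sum-cong-≗ (λ u → adjacency-sym G (punchIn x u) x)) (sym degree≡∑adjacency-punchIn))
                 (sym (sumDeg≡∑degree (G ─ x))) ⟩
      degree G x + (degree G x + sumDeg (G ─ x))      ≡⟨ +-assoc (degree G x) (degree G x) _ ⟨
      degree G x + degree G x + sumDeg (G ─ x)
        ≡⟨ cong (λ d → degree G x + d + sumDeg (G ─ x)) (+-identityʳ (degree G x)) ⟨
      2 * degree G x + sumDeg (G ─ x)                 ∎
      where open ≡-Reasoning

  other-neighbour : ∀ {n} (G : SimpleGraph n) {x} → 2 ≤ degree G x → ∀ p → ∃ λ z → Adj G x z × z ≢ p
  other-neighbour {suc n} G {x} 2≤deg p with ∑-positive (λ u → adjacency G x (punchIn p u)) 1≤others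
    where
    others : ℕ
    others = ∑[ u < n ] adjacency G x (punchIn p u)
    1≤others : 1 ≤ others
    1≤others = +-cancelˡ-≤ 1 1 others (begin
      2                                ≤⟨ 2≤deg ⟩
      degree G x                       ≡⟨ degree≡∑adjacency G x ⟩
      ∑[ w < suc n ] adjacency G x w   ≡⟨ sum-remove (adjacency G x) ⟩
      adjacency G x p + others         ≤⟨ +-monoˡ-≤ others (adjacency≤1 G x p) ⟩
      1 + others                       ∎)
      where open ≤-Reasoning
  ... | u , 0<a = punchIn p u , 0<adjacency⇒Adj G 0<a , Fin.punchInᵢ≢i p u

  module _ {n} (G : SimpleGraph n) (acyclic : Acyclic G) (2≤degree : ∀ x → 2 ≤ degree G x) where

    -- Paths are listed from their newest end x. A neighbour z ≢ p of x either extends the path or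
    -- lies in rest and closes a cycle; since paths have at most n vertices, the fuel runs out.
    path-extends-forever : ∀ fuel x p rest → n < fuel + length (x ∷ p ∷ rest) →
                           Unique (x ∷ p ∷ rest) → Chain G (x ∷ p ∷ rest) → ⊥
    path-extends-forever zero x p rest n<len uniq ch = <⇒≱ n<len (Unique⇒length≤ uniq)
    path-extends-forever (suc fuel) x p rest n<len uniq@((x≢p ∷ x∉rest) ∷ (p∉rest ∷ uniq-rest)) ch
      with other-neighbour G (2≤degree x) p
    ... | z , x~z , z≢p with Any.any? (z Fin.≟_) (x ∷ p ∷ rest)
    ...   | no z∉path = path-extends-forever fuel z x (p ∷ rest)
                          (subst (n <_) (sym (+-suc fuel _)) n<len)
                          (¬Any⇒All¬ (x ∷ p ∷ rest) z∉path ∷ uniq) (Adj-sym G x~z , ch)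
    ...   | yes (here refl) = Adj-irrefl G x~z
    ...   | yes (there (here z≡p)) = z≢p z≡p
    ...   | yes (there (there z∈rest)) = acyclic (x ∷ p ∷ prefixTo rest z∈rest) (3≤length , unique , chain)
      where
      3≤length : 3 ≤ length (x ∷ p ∷ prefixTo rest z∈rest)
      3≤length = s≤s (s≤s (1≤length-prefixTo z∈rest))
      unique : Unique (x ∷ p ∷ prefixTo rest z∈rest)
      unique = (x≢p ∷ All-prefixTo z∈rest x∉rest)
             ∷ (All-prefixTo z∈rest p∉rest ∷ AllPairs-prefixTo z∈rest uniq-rest)
      chain : Chain G (x ∷ p ∷ prefixTo rest z∈rest ++ [ x ])
      chain = proj₁ ch , Chain-prefixTo z∈rest (proj₂ ch) (Adj-sym G x~z)

    no-vertex : Fin n → ⊥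
    no-vertex x with other-neighbour G (2≤degree x) x
    ... | p , x~p , p≢x = path-extends-forever n p x [] (m<m+n n (s≤s z≤n))
                            ((p≢x ∷ []) ∷ ([] ∷ [])) (Adj-sym G x~p , tt)

  Acyclic⇒∃degree≤1 : ∀ {n} (G : SimpleGraph (suc n)) → Acyclic G → ∃ λ x → degree G x ≤ 1
  Acyclic⇒∃degree≤1 G acyclic with Fin.any? (λ x → degree G x ≤? 1)
  ... | yes leaf  = leaf
  ... | no  ¬leaf = ⊥-elim (no-vertex G acyclic (λ x → ≰⇒> (λ deg≤1 → ¬leaf (x , deg≤1))) Fin.zero)

  sumDeg≤2n : ∀ {n} (G : SimpleGraph (suc n)) → Acyclic G → sumDeg G ≤ 2 * n
  sumDeg≤2n {zero}  G _ = ≤-reflexive (trans (+-identityʳ (degree G Fin.zero)) (n≤0⇒n≡0 (degree≤n G Fin.zero)))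
  sumDeg≤2n {suc n} G acyclic with Acyclic⇒∃degree≤1 G acyclic
  ... | x , deg≤1 = begin
    sumDeg G                          ≡⟨ sumDeg-─ G x ⟩
    2 * degree G x + sumDeg (G ─ x)
      ≤⟨ +-mono-≤ (*-monoʳ-≤ 2 deg≤1) (sumDeg≤2n (G ─ x) (Acyclic-─ G x acyclic)) ⟩
    2 * 1 + 2 * n                     ≡⟨ *-distribˡ-+ 2 1 n ⟨
    2 * suc n                         ∎
    where open ≤-Reasoning

import Data.Integer.Properties as ℤ
import Data.Integer.Tactic.RingSolver as ℤ-Solver
import Data.Rational.Properties as ℚ
open import Data.Integer as ℤ using (ℤ; +_; -[1+_]; +≤+; +<+)
open import Data.Integer.DivMod using (_/ℕ_; div-pos-is-/ℕ; [n/ℕd]*d≤n; n<s[n/ℕd]*d)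
open import Data.Nat.Coprimality as Coprimality using (1-coprimeTo)
open import Data.Rational as ℚ using (ℚ; mkℚ; floor; ceiling; ≢-nonZero)
open import Relation.Binary.Definitions using (tri<; tri≈; tri>)
open import Algebra.Properties.Group ℚ.+-0-group using (⁻¹-involutive)

integer : ℤ → ℚ
integer k = mkℚ k 0 (Coprimality.sym (1-coprimeTo ℤ.∣ k ∣))

ℤtoℚ≡integer : ∀ k → ℤtoℚ k ≡ integer k
ℤtoℚ≡integer k = ℚ.↥p/↧p≡p (integer k)

ℤtoℚ-mono-≤ : ∀ {i j} → i ℤ.≤ j → ℤtoℚ i ℚ.≤ ℤtoℚ j
ℤtoℚ-mono-≤ {i} {j} i≤j = subst₂ ℚ._≤_ (sym (ℤtoℚ≡integer i)) (sym (ℤtoℚ≡integer j))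
  (ℚ.*≤* (subst₂ ℤ._≤_ (sym (ℤ.*-identityʳ i)) (sym (ℤ.*-identityʳ j)) i≤j))

ℤtoℚ-cancel-≤ : ∀ {i j} → ℤtoℚ i ℚ.≤ ℤtoℚ j → i ℤ.≤ j
ℤtoℚ-cancel-≤ {i} {j} i≤j with subst₂ ℚ._≤_ (ℤtoℚ≡integer i) (ℤtoℚ≡integer j) i≤j
... | ℚ.*≤* i*1≤j*1 = subst₂ ℤ._≤_ (ℤ.*-identityʳ i) (ℤ.*-identityʳ j) i*1≤j*1

ℤtoℚ-mono-< : ∀ {i j} → i ℤ.< j → ℤtoℚ i ℚ.< ℤtoℚ j
ℤtoℚ-mono-< {i} {j} i<j = subst₂ ℚ._<_ (sym (ℤtoℚ≡integer i)) (sym (ℤtoℚ≡integer j))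
  (ℚ.*<* (subst₂ ℤ._<_ (sym (ℤ.*-identityʳ i)) (sym (ℤ.*-identityʳ j)) i<j))

ℤtoℚ-cancel-< : ∀ {i j} → ℤtoℚ i ℚ.< ℤtoℚ j → i ℤ.< j
ℤtoℚ-cancel-< {i} {j} i<j with subst₂ ℚ._<_ (ℤtoℚ≡integer i) (ℤtoℚ≡integer j) i<j
... | ℚ.*<* i*1<j*1 = subst₂ ℤ._<_ (ℤ.*-identityʳ i) (ℤ.*-identityʳ j) i*1<j*1

ℤtoℚ-homo-* : ∀ i j → ℤtoℚ i ℚ.* ℤtoℚ j ≡ ℤtoℚ (i ℤ.* j)
ℤtoℚ-homo-* i j = cong₂ ℚ._*_ (ℤtoℚ≡integer i) (ℤtoℚ≡integer j)

ℤtoℚ-homo-‿ : ∀ i → ℚ.- ℤtoℚ i ≡ ℤtoℚ (ℤ.- i)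
ℤtoℚ-homo-‿ i = trans (cong ℚ.-_ (ℤtoℚ≡integer i)) (trans (neg-mkℚ i) (sym (ℤtoℚ≡integer (ℤ.- i))))
  where
  neg-mkℚ : ∀ i → ℚ.- integer i ≡ integer (ℤ.- i)
  neg-mkℚ (+ zero)  = refl
  neg-mkℚ (+ suc _) = refl
  neg-mkℚ -[1+ _ ]  = refl

ℤtoℚ-homo-- : ∀ i j → ℤtoℚ i ℚ.- ℤtoℚ j ≡ ℤtoℚ (i ℤ.- j)
ℤtoℚ-homo-- i j = begin
  ℤtoℚ i ℚ.+ ℚ.- ℤtoℚ j          ≡⟨ cong (ℤtoℚ i ℚ.+_) (ℤtoℚ-homo-‿ j) ⟩
  ℤtoℚ i ℚ.+ ℤtoℚ (ℤ.- j)        ≡⟨ cong₂ ℚ._+_ (ℤtoℚ≡integer i) (ℤtoℚ≡integer (ℤ.- j)) ⟩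
  integer i ℚ.+ integer (ℤ.- j)  ≡⟨ cong (ℚ._/ 1) (cong₂ ℤ._+_ (ℤ.*-identityʳ i) (ℤ.*-identityʳ (ℤ.- j))) ⟩
  ℤtoℚ (i ℤ.- j)                 ∎
  where open ≡-Reasoning

floor-≤ : ∀ q → ℤtoℚ (floor q) ℚ.≤ q
floor-≤ q@(mkℚ a d _) = subst (ℚ._≤ q) (sym (ℤtoℚ≡integer (floor q)))
  (ℚ.*≤* (subst₂ ℤ._≤_ (cong (ℤ._* + suc d) (sym (div-pos-is-/ℕ a (suc d)))) (sym (ℤ.*-identityʳ a))
                       ([n/ℕd]*d≤n a (suc d))))

≤-floor : ∀ {k} q → ℤtoℚ k ℚ.≤ q → k ℤ.≤ floor q
≤-floor {k} q@(mkℚ a d _) k≤q with subst (ℚ._≤ q) (ℤtoℚ≡integer k) k≤q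
... | ℚ.*≤* k*d≤a*1 = subst (k ℤ.≤_) (trans (ℤ.pred-suc (a /ℕ suc d)) (sym (div-pos-is-/ℕ a (suc d))))
                        (ℤ.i<j⇒i≤pred[j] k<1+a/d)
  where
  k<1+a/d : k ℤ.< ℤ.suc (a /ℕ suc d)
  k<1+a/d = ℤ.*-cancelʳ-<-nonNeg (+ suc d) (begin-strict
    k ℤ.* + suc d                   ≤⟨ subst (k ℤ.* + suc d ℤ.≤_) (ℤ.*-identityʳ a) k*d≤a*1 ⟩
    a                               <⟨ n<s[n/ℕd]*d a (suc d) ⟩
    ℤ.suc (a /ℕ suc d) ℤ.* + suc d  ∎)
    where open ℤ.≤-Reasoning

≤-ceiling : ∀ q → q ℚ.≤ ℤtoℚ (ceiling q)
≤-ceiling q@(mkℚ _ _ _) = subst₂ ℚ._≤_ (⁻¹-involutive q) (ℤtoℚ-homo-‿ (floor (ℚ.- q)))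
                            (ℚ.neg-antimono-≤ (floor-≤ (ℚ.- q)))

ceiling-≤ : ∀ {k} q → q ℚ.≤ ℤtoℚ k → ceiling q ℤ.≤ k
ceiling-≤ {k} q@(mkℚ _ _ _) q≤k = subst (ceiling q ℤ.≤_) (ℤ.neg-involutive k)
  (ℤ.neg-mono-≤ (≤-floor (ℚ.- q) (subst (ℚ._≤ ℚ.- q) (ℤtoℚ-homo-‿ k) (ℚ.neg-antimono-≤ q≤k))))

≤⇒≤-ceiling : ∀ {k} q → ℤtoℚ k ℚ.≤ q → k ℤ.≤ ceiling q
≤⇒≤-ceiling q k≤q = ℤtoℚ-cancel-≤ (ℚ.≤-trans k≤q (≤-ceiling q))

1≤ceiling : ∀ q → ℚ.0ℚ ℚ.< q → + 1 ℤ.≤ ceiling q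
1≤ceiling q 0<q = ℤ.i<j⇒suc[i]≤j (ℤtoℚ-cancel-< {+ 0} (ℚ.<-≤-trans 0<q (≤-ceiling q)))

/₀-*-inverse : ∀ p {q} → q ≢ ℚ.0ℚ → p /₀ q ℚ.* q ≡ p
/₀-*-inverse p {q} q≢0 with q ℚ.≟ ℚ.0ℚ
... | yes q≡0  = ⊥-elim (q≢0 q≡0)
... | no  q≢0′ = begin
  p ℚ.* ℚ.1/ q ℚ.* q    ≡⟨ ℚ.*-assoc p (ℚ.1/ q) q ⟩
  p ℚ.* (ℚ.1/ q ℚ.* q)  ≡⟨ cong (p ℚ.*_) (ℚ.*-inverseˡ q) ⟩
  p ℚ.* ℚ.1ℚ            ≡⟨ ℚ.*-identityʳ p ⟩
  p                     ∎
  where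
  open ≡-Reasoning
  instance _ = ≢-nonZero q≢0′

module _ {p q : ℚ} where

  private
    >⇒≢ : ∀ {q} → ℚ.0ℚ ℚ.< q → q ≢ ℚ.0ℚ
    >⇒≢ 0<q = ≢-sym (ℚ.<⇒≢ 0<q)

  /₀-≤⇒≤-* : ∀ {r} → ℚ.0ℚ ℚ.< q → p /₀ q ℚ.≤ r → p ℚ.≤ r ℚ.* q
  /₀-≤⇒≤-* 0<q p/q≤r = subst (ℚ._≤ _) (/₀-*-inverse p (>⇒≢ 0<q)) (ℚ.*-monoʳ-≤-nonNeg q p/q≤r)
    where instance _ = ℚ.pos⇒nonNeg q {{ℚ.positive 0<q}}

  ≤-*⇒/₀-≤ : ∀ {r} → ℚ.0ℚ ℚ.< q → p ℚ.≤ r ℚ.* q → p /₀ q ℚ.≤ r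
  ≤-*⇒/₀-≤ 0<q p≤rq = ℚ.*-cancelʳ-≤-pos q (subst (ℚ._≤ _) (sym (/₀-*-inverse p (>⇒≢ 0<q))) p≤rq)
    where instance _ = ℚ.positive 0<q

  ≤-*⇒≤-/₀-neg : ∀ {r} → q ℚ.< ℚ.0ℚ → p ℚ.≤ r ℚ.* q → r ℚ.≤ p /₀ q
  ≤-*⇒≤-/₀-neg q<0 p≤rq =
    ℚ.*-cancelʳ-≤-neg q (subst (ℚ._≤ _) (sym (/₀-*-inverse p (ℚ.<⇒≢ q<0))) p≤rq)
    where instance _ = ℚ.negative q<0

  /₀-pos : ℚ.0ℚ ℚ.< p → ℚ.0ℚ ℚ.< q → ℚ.0ℚ ℚ.< p /₀ q
  /₀-pos 0<p 0<q = ℚ.*-cancelʳ-<-nonNeg q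
    (subst₂ ℚ._<_ (sym (ℚ.*-zeroˡ q)) (sym (/₀-*-inverse p (>⇒≢ 0<q))) 0<p)
    where instance _ = ℚ.pos⇒nonNeg q {{ℚ.positive 0<q}}

  /₀-nonNeg : ℚ.0ℚ ℚ.≤ p → ℚ.0ℚ ℚ.≤ q → ℚ.0ℚ ℚ.≤ p /₀ q
  /₀-nonNeg 0≤p 0≤q with ℚ.<-cmp ℚ.0ℚ q
  ... | tri< 0<q _ _ = ℚ.*-cancelʳ-≤-pos q
    (subst₂ ℚ._≤_ (sym (ℚ.*-zeroˡ q)) (sym (/₀-*-inverse p (>⇒≢ 0<q))) 0≤p)
    where instance _ = ℚ.positive 0<q
  ... | tri≈ _ 0≡q _ = subst (λ q → ℚ.0ℚ ℚ.≤ p /₀ q) 0≡q ℚ.≤-refl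
  ... | tri> _ _ q<0 = ⊥-elim (ℚ.<-irrefl refl (ℚ.≤-<-trans 0≤q q<0))

  <-*⇒/₀-< : ∀ {r} → ℚ.0ℚ ℚ.< q → p ℚ.< r ℚ.* q → p /₀ q ℚ.< r
  <-*⇒/₀-< 0<q p<rq = ℚ.*-cancelʳ-<-nonNeg q (subst (ℚ._< _) (sym (/₀-*-inverse p (>⇒≢ 0<q))) p<rq)
    where instance _ = ℚ.pos⇒nonNeg q {{ℚ.positive 0<q}}

p≤q⇒0≤q-p : ∀ {p q} → p ℚ.≤ q → ℚ.0ℚ ℚ.≤ q ℚ.- p
p≤q⇒0≤q-p {p} {q} p≤q = subst (ℚ._≤ q ℚ.- p) (ℚ.+-inverseʳ p) (ℚ.+-monoˡ-≤ (ℚ.- p) p≤q)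

p<q⇒0<q-p : ∀ {p q} → p ℚ.< q → ℚ.0ℚ ℚ.< q ℚ.- p
p<q⇒0<q-p {p} {q} p<q = subst (ℚ._< q ℚ.- p) (ℚ.+-inverseʳ p) (ℚ.+-monoˡ-< (ℚ.- p) p<q)

p<q⇒p-q<0 : ∀ {p q} → p ℚ.< q → p ℚ.- q ℚ.< ℚ.0ℚ
p<q⇒p-q<0 {p} {q} p<q = subst (p ℚ.- q ℚ.<_) (ℚ.+-inverseʳ q) (ℚ.+-monoˡ-< (ℚ.- q) p<q)

module Ratios (n m Δ s : ℕ) where

  N : ℚ
  N = ℕtoℚ n

  η : ℤ
  η = ceiling (ℕtoℚ (2 ℕ.* n ℕ.* Δ) /₀ ℕtoℚ m)

  E : ℚ
  E = ℤtoℚ η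

  avg : ℚ
  avg = ℕtoℚ s /₀ N

  A : ℤ
  A = floor (N /₀ (N ℚ.- E))

  B : ℤ
  B = ceiling (N /₀ (E ℚ.- avg))

  data Bounds : Set where
    η-small : + 0 ℤ.≤ A → + 0 ℤ.≤ B → Bounds
    η-large : 1 ℕ.≤ m → m ℕ.< 2 ℕ.* Δ → ℤ.- + m ℤ.≤ A → + 1 ℤ.≤ B → Bounds

  module _ (1≤n : 1 ℕ.≤ n) where

    0<N : ℚ.0ℚ ℚ.< N
    0<N = ℤtoℚ-mono-< (+<+ 1≤n)

    η≤n⇒0≤A : η ℤ.≤ + n → + 0 ℤ.≤ A
    η≤n⇒0≤A η≤n = ≤-floor _ (/₀-nonNeg (ℚ.<⇒≤ 0<N)
      (subst (ℚ.0ℚ ℚ.≤_) (sym (ℤtoℚ-homo-- (+ n) η)) (ℤtoℚ-mono-≤ (ℤ.i≤j⇒0≤j-i η≤n))))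

    -k≤A : ∀ k → + n ℤ.< η → + n ℤ.≤ k ℤ.* (η ℤ.- + n) → ℤ.- k ℤ.≤ A
    -k≤A k n<η n≤k[η-n] = ≤-floor _ (≤-*⇒≤-/₀-neg (p<q⇒p-q<0 (ℤtoℚ-mono-< n<η)) (begin
      N                                  ≤⟨ ℤtoℚ-mono-≤ n≤k[η-n] ⟩
      ℤtoℚ (k ℤ.* (η ℤ.- + n))            ≡⟨ cong ℤtoℚ (k[η-n]≡-k[n-η] k η (+ n)) ⟩
      ℤtoℚ (ℤ.- k ℤ.* (+ n ℤ.- η))        ≡⟨ sym (ℤtoℚ-homo-* (ℤ.- k) (+ n ℤ.- η)) ⟩
      ℤtoℚ (ℤ.- k) ℚ.* ℤtoℚ (+ n ℤ.- η)   ≡⟨ cong (ℤtoℚ (ℤ.- k) ℚ.*_) (sym (ℤtoℚ-homo-- (+ n) η)) ⟩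
      ℤtoℚ (ℤ.- k) ℚ.* (N ℚ.- E)          ∎))
      where
      open ℚ.≤-Reasoning
      k[η-n]≡-k[n-η] : ∀ k η n → k ℤ.* (η ℤ.- n) ≡ ℤ.- k ℤ.* (n ℤ.- η)
      k[η-n]≡-k[n-η] = ℤ-Solver.solve-∀

    s≤ηn⇒0≤B : + s ℤ.≤ η ℤ.* + n → + 0 ℤ.≤ B
    s≤ηn⇒0≤B s≤ηn = ≤⇒≤-ceiling _ (/₀-nonNeg (ℚ.<⇒≤ 0<N) (p≤q⇒0≤q-p avg≤E))
      where
      avg≤E : avg ℚ.≤ E
      avg≤E = ≤-*⇒/₀-≤ 0<N
        (subst (ℕtoℚ s ℚ.≤_) (sym (ℤtoℚ-homo-* η (+ n))) (ℤtoℚ-mono-≤ s≤ηn))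

    s<ηn⇒1≤B : + s ℤ.< η ℤ.* + n → + 1 ℤ.≤ B
    s<ηn⇒1≤B s<ηn = 1≤ceiling _ (/₀-pos 0<N (p<q⇒0<q-p avg<E))
      where
      avg<E : avg ℚ.< E
      avg<E = <-*⇒/₀-< 0<N
        (subst (ℕtoℚ s ℚ.<_) (sym (ℤtoℚ-homo-* η (+ n))) (ℤtoℚ-mono-< s<ηn))

    module _ (1≤m : 1 ℕ.≤ m) where

      0<M : ℚ.0ℚ ℚ.< ℕtoℚ m
      0<M = ℤtoℚ-mono-< (+<+ 1≤m)

      2nΔ≤ηm : + (2 ℕ.* n ℕ.* Δ) ℤ.≤ η ℤ.* + m
      2nΔ≤ηm = ℤtoℚ-cancel-≤ (subst (ℕtoℚ (2 ℕ.* n ℕ.* Δ) ℚ.≤_) (ℤtoℚ-homo-* η (+ m))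
                                     (/₀-≤⇒≤-* 0<M (≤-ceiling (ℕtoℚ (2 ℕ.* n ℕ.* Δ) /₀ ℕtoℚ m))))

      2Δ≤η : m ℕ.≤ n → + (2 ℕ.* Δ) ℤ.≤ η
      2Δ≤η m≤n = ℤ.*-cancelʳ-≤-pos (+ (2 ℕ.* Δ)) η (+ m) (begin
        + (2 ℕ.* Δ) ℤ.* + m        ≡⟨ ℤ.pos-* (2 ℕ.* Δ) m ⟨
        + (2 ℕ.* Δ ℕ.* m)          ≤⟨ +≤+ 2Δm≤2nΔ ⟩
        + (2 ℕ.* n ℕ.* Δ)          ≤⟨ 2nΔ≤ηm ⟩
        η ℤ.* + m                  ∎)
        where
        open ℤ.≤-Reasoning
        instance _ = ℤ.positive (+<+ 1≤m)
        2Δm≤2nΔ : 2 ℕ.* Δ ℕ.* m ℕ.≤ 2 ℕ.* n ℕ.* Δ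
        2Δm≤2nΔ = ℕ.≤-trans (ℕ.*-monoʳ-≤ (2 ℕ.* Δ) m≤n) (ℕ.≤-reflexive (2Δn≡2nΔ Δ n))
          where
          2Δn≡2nΔ : ∀ Δ n → 2 ℕ.* Δ ℕ.* n ≡ 2 ℕ.* n ℕ.* Δ
          2Δn≡2nΔ = solve-∀

      2Δ≤m⇒η≤n : 2 ℕ.* Δ ℕ.≤ m → η ℤ.≤ + n
      2Δ≤m⇒η≤n 2Δ≤m = ceiling-≤ _ (≤-*⇒/₀-≤ 0<M
        (subst (ℕtoℚ (2 ℕ.* n ℕ.* Δ) ℚ.≤_)
               (trans (cong ℤtoℚ (ℤ.pos-* n m)) (sym (ℤtoℚ-homo-* (+ n) (+ m))))
               (ℤtoℚ-mono-≤ (+≤+ 2nΔ≤nm))))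
        where
        2nΔ≤nm : 2 ℕ.* n ℕ.* Δ ℕ.≤ n ℕ.* m
        2nΔ≤nm = ℕ.≤-trans (ℕ.≤-reflexive (2nΔ≡n2Δ n Δ)) (ℕ.*-monoʳ-≤ n 2Δ≤m)
          where
          2nΔ≡n2Δ : ∀ n Δ → 2 ℕ.* n ℕ.* Δ ≡ n ℕ.* (2 ℕ.* Δ)
          2nΔ≡n2Δ = solve-∀

      s<ηn : m ℕ.≤ n → s ≡ 2 ℕ.* m → s ℕ.≤ n ℕ.* Δ → + s ℤ.< η ℤ.* + n
      s<ηn m≤n s≡2m s≤nΔ = begin-strict
        + s                     ≤⟨ +≤+ s≤nΔ ⟩
        + (n ℕ.* Δ)             <⟨ +<+ nΔ<2Δn ⟩
        + (2 ℕ.* Δ ℕ.* n)       ≡⟨ ℤ.pos-* (2 ℕ.* Δ) n ⟩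
        + (2 ℕ.* Δ) ℤ.* + n     ≤⟨ ℤ.*-monoʳ-≤-nonNeg (+ n) (2Δ≤η m≤n) ⟩
        η ℤ.* + n               ∎
        where
        open ℤ.≤-Reasoning
        nΔ<2Δn : n ℕ.* Δ ℕ.< 2 ℕ.* Δ ℕ.* n
        nΔ<2Δn = ℕ.<-≤-trans (ℕ.m<m+n (n ℕ.* Δ) 0<nΔ) (ℕ.≤-reflexive (nΔ+nΔ≡2Δn n Δ))
          where
          0<nΔ : 0 ℕ.< n ℕ.* Δ
          0<nΔ = ℕ.≤-trans 1≤m (ℕ.≤-trans (ℕ.m≤n*m m 2) (subst (ℕ._≤ n ℕ.* Δ) s≡2m s≤nΔ))
          nΔ+nΔ≡2Δn : ∀ n Δ → n ℕ.* Δ ℕ.+ n ℕ.* Δ ≡ 2 ℕ.* Δ ℕ.* n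
          nΔ+nΔ≡2Δn = solve-∀

      n≤m[η-n] : m ℕ.< 2 ℕ.* Δ → + n ℤ.≤ + m ℤ.* (η ℤ.- + n)
      n≤m[η-n] m<2Δ = begin
        + n                                        ≡⟨ x≡x+y-y (+ n) (+ n ℤ.* + m) ⟩
        + n ℤ.+ + n ℤ.* + m ℤ.- + n ℤ.* + m        ≤⟨ ℤ.+-monoˡ-≤ (ℤ.- (+ n ℤ.* + m)) n+nm≤ηm ⟩
        η ℤ.* + m ℤ.- + n ℤ.* + m                  ≡⟨ ηm-nm≡m[η-n] η (+ m) (+ n) ⟩
        + m ℤ.* (η ℤ.- + n)                        ∎
        where
        open ℤ.≤-Reasoning
        x≡x+y-y : ∀ x y → x ≡ x ℤ.+ y ℤ.- y
        x≡x+y-y = ℤ-Solver.solve-∀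
        ηm-nm≡m[η-n] : ∀ η m n → η ℤ.* m ℤ.- n ℤ.* m ≡ m ℤ.* (η ℤ.- n)
        ηm-nm≡m[η-n] = ℤ-Solver.solve-∀
        n+nm≤ηm : + n ℤ.+ + n ℤ.* + m ℤ.≤ η ℤ.* + m
        n+nm≤ηm = begin
          + n ℤ.+ + n ℤ.* + m      ≡⟨ cong (λ x → + n ℤ.+ x) (ℤ.pos-* n m) ⟨
          + n ℤ.+ + (n ℕ.* m)      ≡⟨ ℤ.pos-+ n (n ℕ.* m) ⟨
          + (n ℕ.+ n ℕ.* m)        ≡⟨ cong +_ (ℕ.*-suc n m) ⟨
          + (n ℕ.* suc m)          ≤⟨ +≤+ (ℕ.*-monoʳ-≤ n m<2Δ) ⟩
          + (n ℕ.* (2 ℕ.* Δ))      ≡⟨ cong +_ (n2Δ≡2nΔ n Δ) ⟩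
          + (2 ℕ.* n ℕ.* Δ)        ≤⟨ 2nΔ≤ηm ⟩
          η ℤ.* + m                ∎
          where
          n2Δ≡2nΔ : ∀ n Δ → n ℕ.* (2 ℕ.* Δ) ≡ 2 ℕ.* n ℕ.* Δ
          n2Δ≡2nΔ = solve-∀

      bounds-1≤m : m ℕ.< n → s ≡ 2 ℕ.* m → s ℕ.≤ n ℕ.* Δ → Bounds
      bounds-1≤m m<n s≡2m s≤nΔ with η ℤ.≤? + n
      ... | yes η≤n = η-small (η≤n⇒0≤A η≤n)
                              (s≤ηn⇒0≤B (ℤ.<⇒≤ (s<ηn (ℕ.<⇒≤ m<n) s≡2m s≤nΔ)))
      ... | no  η≰n = η-large 1≤m m<2Δ (-k≤A (+ m) (ℤ.≰⇒> η≰n) (n≤m[η-n] m<2Δ))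
                              (s<ηn⇒1≤B (s<ηn (ℕ.<⇒≤ m<n) s≡2m s≤nΔ))
        where
        m<2Δ : m ℕ.< 2 ℕ.* Δ
        m<2Δ = ℕ.≰⇒> (λ 2Δ≤m → η≰n (2Δ≤m⇒η≤n 2Δ≤m))

bounds : ∀ {n m Δ s} → 1 ℕ.≤ n → m ℕ.< n → s ≡ 2 ℕ.* m → s ℕ.≤ n ℕ.* Δ → Ratios.Bounds n m Δ s
-- Without edges η = ⌈2nΔ /₀ 0⌉ reduces to 0, by the convention p /₀ 0 = 0.
bounds {n} {zero}  {Δ} {s} 1≤n _ s≡0 _ =
  η-small (η≤n⇒0≤A 1≤n (+≤+ z≤n)) (s≤ηn⇒0≤B 1≤n (+≤+ (ℕ.≤-reflexive s≡0)))
  where open Ratios n zero Δ s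
bounds {n} {suc m} {Δ} {s} 1≤n m<n s≡2m s≤nΔ = bounds-1≤m 1≤n (s≤s z≤n) m<n s≡2m s≤nΔ
  where open Ratios n (suc m) Δ s

module _ {η₁ A B : ℤ} (0≤η₁ : + 0 ℤ.≤ η₁) where

  private instance _ = ℤ.nonNegative 0≤η₁

  σ≤η₁A+η₁B+S-when-nonNeg : ∀ {σ S} → σ ℕ.≤ S → + 0 ℤ.≤ A → + 0 ℤ.≤ B →
                            + σ ℤ.≤ η₁ ℤ.* A ℤ.+ η₁ ℤ.* B ℤ.+ + S
  σ≤η₁A+η₁B+S-when-nonNeg {σ} {S} σ≤S 0≤A 0≤B = begin
    + σ                               ≤⟨ +≤+ σ≤S ⟩
    + S                               ≡⟨ cong (ℤ._+ + S) (cong₂ ℤ._+_ (ℤ.*-zeroʳ η₁) (ℤ.*-zeroʳ η₁)) ⟨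
    η₁ ℤ.* + 0 ℤ.+ η₁ ℤ.* + 0 ℤ.+ + S
      ≤⟨ ℤ.+-monoˡ-≤ (+ S) (ℤ.+-mono-≤ (ℤ.*-monoˡ-≤-nonNeg η₁ 0≤A) (ℤ.*-monoˡ-≤-nonNeg η₁ 0≤B)) ⟩
    η₁ ℤ.* A ℤ.+ η₁ ℤ.* B ℤ.+ + S     ∎
    where open ℤ.≤-Reasoning

  σ≤η₁A+η₁B+S-when-A≥-m : ∀ {σ S m} → η₁ ℤ.≤ + 4 → 1 ℕ.≤ m → σ ℕ.+ 4 ℕ.* (m ℕ.∸ 1) ℕ.≤ S →
                          ℤ.- + m ℤ.≤ A → + 1 ℤ.≤ B → + σ ℤ.≤ η₁ ℤ.* A ℤ.+ η₁ ℤ.* B ℤ.+ + S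
  σ≤η₁A+η₁B+S-when-A≥-m {σ} {S} {suc m} η₁≤4 _ σ+4m≤S -[1+m]≤A 1≤B = begin
    + σ                                  ≡⟨ x≡-y+[x+y] (+ σ) (+ (4 ℕ.* m)) ⟩
    ℤ.- + (4 ℕ.* m) ℤ.+ (+ σ ℤ.+ + (4 ℕ.* m)) ≤⟨ ℤ.+-monoʳ-≤ (ℤ.- + (4 ℕ.* m)) (+≤+ σ+4m≤S) ⟩
    ℤ.- + (4 ℕ.* m) ℤ.+ + S              ≤⟨ ℤ.+-monoˡ-≤ (+ S) -4m≤η₁A+η₁B ⟩
    η₁ ℤ.* A ℤ.+ η₁ ℤ.* B ℤ.+ + S        ∎
    where
    open ℤ.≤-Reasoning
    x≡-y+[x+y] : ∀ x y → x ≡ ℤ.- y ℤ.+ (x ℤ.+ y)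
    x≡-y+[x+y] = ℤ-Solver.solve-∀
    -m≤A+B : ℤ.- + m ℤ.≤ A ℤ.+ B
    -m≤A+B = subst (ℤ._≤ A ℤ.+ B) (-[1+m]+1≡-m (+ m)) (ℤ.+-mono-≤ -[1+m]≤A 1≤B)
      where
      -[1+m]+1≡-m : ∀ m → ℤ.- (+ 1 ℤ.+ m) ℤ.+ + 1 ≡ ℤ.- m
      -[1+m]+1≡-m = ℤ-Solver.solve-∀
    instance _ = ℤ.nonPositive (ℤ.neg-mono-≤ (+≤+ (z≤n {m})))
    -4m≤η₁A+η₁B : ℤ.- + (4 ℕ.* m) ℤ.≤ η₁ ℤ.* A ℤ.+ η₁ ℤ.* B
    -4m≤η₁A+η₁B = begin
      ℤ.- + (4 ℕ.* m)      ≡⟨ cong ℤ.-_ (ℤ.pos-* 4 m) ⟩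
      ℤ.- (+ 4 ℤ.* + m)    ≡⟨ ℤ.neg-distribʳ-* (+ 4) (+ m) ⟩
      + 4 ℤ.* ℤ.- + m      ≤⟨ ℤ.*-monoʳ-≤-nonPos (ℤ.- + m) η₁≤4 ⟩
      η₁ ℤ.* ℤ.- + m       ≤⟨ ℤ.*-monoˡ-≤-nonNeg η₁ -m≤A+B ⟩
      η₁ ℤ.* (A ℤ.+ B)     ≡⟨ ℤ.*-distribˡ-+ η₁ A B ⟩
      η₁ ℤ.* A ℤ.+ η₁ ℤ.* B ∎

open DegreeSums using (handshake; sumDeg≤n*maxDegree; sigma+Δ[Δ∸1]+2m≤sumDegCubes)
open Forests using (sumDeg≤2n)
open NatArithmetic using (σ+4[m∸1]≤S)
open import Data.Integer using (_+_; _*_; _<_; _≤_)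
open import Data.Rational using (_-_)

theorem5 : (n : ℕ) (T : SimpleGraph n) → IsTree T →
    (η₁ : ℤ) → + 2 < η₁ → η₁ ≤ + 4 →
    + sigma T ≤
    η₁ * floor (ℕtoℚ n /₀ (ℕtoℚ n - ℤtoℚ (eta T)))
    + η₁ * ceiling (ℕtoℚ n /₀ (ℤtoℚ (eta T) - avgDeg T))
    + + sumDegCubes T
theorem5 (suc k) T (_ , _ , acyclic) η₁ 2<η₁ η₁≤4 =
  σ-bound (bounds (s≤s z≤n) m<n (handshake T) (sumDeg≤n*maxDegree T))
  where
  m = numEdges T
  Δ = maxDegree T
  m<n : m ℕ.< suc k
  m<n = s≤s (ℕ.*-cancelˡ-≤ 2 (subst (ℕ._≤ 2 ℕ.* k) (handshake T) (sumDeg≤2n T acyclic)))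
  σ+Δ[Δ∸1]+2m≤S : sigma T ℕ.+ (Δ ℕ.* (Δ ℕ.∸ 1) ℕ.+ 2 ℕ.* m) ℕ.≤ sumDegCubes T
  σ+Δ[Δ∸1]+2m≤S = sigma+Δ[Δ∸1]+2m≤sumDegCubes T
  0≤η₁ : + 0 ≤ η₁
  0≤η₁ = ℤ.≤-trans (+≤+ z≤n) (ℤ.<⇒≤ 2<η₁)
  open Ratios (suc k) m Δ (sumDeg T) using (Bounds; A; B; η-small; η-large)
  σ-bound : Bounds → + sigma T ≤ η₁ * A + η₁ * B + + sumDegCubes T
  σ-bound (η-small 0≤A 0≤B) =
    σ≤η₁A+η₁B+S-when-nonNeg 0≤η₁ (ℕ.≤-trans (ℕ.m≤m+n (sigma T) _) σ+Δ[Δ∸1]+2m≤S) 0≤A 0≤B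
  σ-bound (η-large 1≤m m<2Δ -m≤A 1≤B) =
    σ≤η₁A+η₁B+S-when-A≥-m 0≤η₁ η₁≤4 1≤m (σ+4[m∸1]≤S {sigma T} {Δ} m<2Δ σ+Δ[Δ∸1]+2m≤S) -m≤A 1≤B
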